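{- Consider two-pile Sharing Nim. (i) If the current position $(x_1,x_2)$ has nim-sum $x_1 \oplus x_2 = 0$, then every legal move (removal or transfer) leads to a position with nonzero nim-sum. (ii) If the current position has nonzero nim-sum, then there is a legal move leading to a position with nim-sum $0$.
   Context: Sharing Nim (here with 2 piles): a position is a tuple of nonnegative integers (pile sizes). Two players alternate moves. A move is either (a) removing a positive number of objects from one pile, or (b) transferring a positive number of objects from one pile to another pile, subject to the restriction that objects may not be transferred from a pile of greater size to a pile of smaller size (i.e., the source pile's size must be at most the destination pile's size before the move). The player who removes the last object wins (a player with no legal move loses). The nim-sum $\oplus$ is the bitwise exclusive-or of the pile sizes. -}

module Defs where

open import Data.Nat using (ℕ; zero; suc; _+_; _*_; _≤_; _<_)
open import Data.Nat.DivMod using (_/_; _%_)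
open import Data.Bool using (Bool; true; false; _xor_)
open import Data.Product using (_×_; _,_)
open import Relation.Binary.PropositionalEquality using (_≡_)

bit : ℕ → Bool
bit n = Data.Nat._≡ᵇ_ (n % 2) 1

fromBit : Bool → ℕ
fromBit true  = 1
fromBit false = 0

-- bitwise xor with fuel; fuel ≥ number of binary digits suffices
xorFuel : ℕ → ℕ → ℕ → ℕ
xorFuel zero    a b = 0
xorFuel (suc k) a b = fromBit (bit a xor bit b) + 2 * xorFuel k (a / 2) (b / 2)

-- the nim-sum (bitwise exclusive-or); fuel a + b is enough since each
-- step halves the arguments
_⊕_ : ℕ → ℕ → ℕ
a ⊕ b = xorFuel (a + b) a b

infixl 6 _⊕_

Pos : Set
Pos = ℕ × ℕ

data Move : Pos → Pos → Set where
  -- remove k ≥ 1 objects from pile 1 / pile 2 (y + k ≡ x means y = x - k, k ≤ x)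
  remove₁ : ∀ {x₁ x₂} k → 1 ≤ k → ∀ {y} → y + k ≡ x₁ → Move (x₁ , x₂) (y , x₂)
  remove₂ : ∀ {x₁ x₂} k → 1 ≤ k → ∀ {y} → y + k ≡ x₂ → Move (x₁ , x₂) (x₁ , y)
  transfer₁₂ : ∀ {x₁ x₂} k → 1 ≤ k → x₁ ≤ x₂ → ∀ {y} → y + k ≡ x₁ → Move (x₁ , x₂) (y , x₂ + k)
  transfer₂₁ : ∀ {x₁ x₂} k → 1 ≤ k → x₂ ≤ x₁ → ∀ {y} → y + k ≡ x₂ → Move (x₁ , x₂) (x₁ + k , y)

-- On two piles the nim-sum vanishes exactly on the diagonal x₁ = x₂. Every
-- move from a diagonal position changes one pile only, or shifts k objects
-- from one pile to the other, so it leaves the diagonal; and from an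
-- off-diagonal position, removing the excess from the larger pile reaches it.
module Submission where

open import Defs
open import Data.Nat using (ℕ; zero; suc; _+_; _*_; _≤_; _<_; _∸_; pred; z≤n; s≤s; s≤s⁻¹)
open import Data.Nat.Properties
open import Data.Nat.DivMod using (_/_; _%_; m%n<n; m/n<m; m/n≤m; m≡m%n+[m/n]*n)
open import Data.Bool using (true; false; _xor_)
open import Data.Product using (_×_; _,_; Σ; ∃; proj₁; proj₂)
open import Relation.Binary.PropositionalEquality
open import Relation.Binary.Definitions using (tri<; tri≈; tri>)
open import Relation.Nullary using (¬_; contradiction)

%2≡fromBit-bit : ∀ a → a % 2 ≡ fromBit (bit a)
%2≡fromBit-bit a with a % 2 | m%n<n a 2
... | 0 | _ = refl
... | 1 | _ = refl
... | suc (suc _) | s≤s (s≤s ())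

bit≡⇒%2≡ : ∀ a b → bit a ≡ bit b → a % 2 ≡ b % 2
bit≡⇒%2≡ a b bits = begin
  a % 2            ≡⟨ %2≡fromBit-bit a ⟩
  fromBit (bit a)  ≡⟨ cong fromBit bits ⟩
  fromBit (bit b)  ≡⟨ sym (%2≡fromBit-bit b) ⟩
  b % 2            ∎
  where open ≡-Reasoning

%2-/2-injective : ∀ {a b} → a % 2 ≡ b % 2 → a / 2 ≡ b / 2 → a ≡ b
%2-/2-injective {a} {b} r q = begin
  a                    ≡⟨ m≡m%n+[m/n]*n a 2 ⟩
  a % 2 + a / 2 * 2    ≡⟨ cong₂ (λ u v → u + v * 2) r q ⟩
  b % 2 + b / 2 * 2    ≡⟨ sym (m≡m%n+[m/n]*n b 2) ⟩
  b                    ∎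
  where open ≡-Reasoning

/2≤pred : ∀ a → a / 2 ≤ pred a
/2≤pred zero    = ≤-refl
/2≤pred (suc a) = s≤s⁻¹ (m/n<m (suc a) 2 (s≤s (s≤s z≤n)))

-- Unlike a strict bound a / 2 + b / 2 < a + b, this also holds at a + b = 0,
-- so the fuel recursion in xorFuel≡0⇒≡ needs no case split.
/2+/2≤pred-+ : ∀ a b → a / 2 + b / 2 ≤ pred (a + b)
/2+/2≤pred-+ zero    b = /2≤pred b
/2+/2≤pred-+ (suc a) b = +-mono-≤ (/2≤pred (suc a)) (m/n≤m b 2)

xor-digit≡0 : ∀ p q n → fromBit (p xor q) + 2 * n ≡ 0 → p ≡ q × n ≡ 0
xor-digit≡0 true  true  zero _ = refl , refl
xor-digit≡0 false false zero _ = refl , refl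
xor-digit≡0 true  false _ ()
xor-digit≡0 false true  _ ()
xor-digit≡0 true  true  (suc _) ()
xor-digit≡0 false false (suc _) ()

xorFuel-self : ∀ k a → xorFuel k a a ≡ 0
xorFuel-self zero    a = refl
xorFuel-self (suc k) a rewrite xorFuel-self k (a / 2) with bit a
... | true  = refl
... | false = refl

xorFuel≡0⇒≡ : ∀ k a b → a + b ≤ k → xorFuel k a b ≡ 0 → a ≡ b
xorFuel≡0⇒≡ zero a b a+b≤0 _ =
  trans (m+n≡0⇒m≡0 a a+b≡0) (sym (m+n≡0⇒n≡0 a a+b≡0))
  where a+b≡0 = n≤0⇒n≡0 a+b≤0
xorFuel≡0⇒≡ (suc k) a b a+b≤1+k xor≡0
  with xor-digit≡0 (bit a) (bit b) _ xor≡0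
... | bits , rest = %2-/2-injective (bit≡⇒%2≡ a b bits)
  (xorFuel≡0⇒≡ k (a / 2) (b / 2) halves≤k rest)
  where
  halves≤k : a / 2 + b / 2 ≤ k
  halves≤k = ≤-trans (/2+/2≤pred-+ a b) (pred-mono-≤ a+b≤1+k)

⊕-self : ∀ a → a ⊕ a ≡ 0
⊕-self a = xorFuel-self (a + a) a

⊕≡0⇒≡ : ∀ {a b} → a ⊕ b ≡ 0 → a ≡ b
⊕≡0⇒≡ {a} {b} = xorFuel≡0⇒≡ (a + b) a b ≤-refl

+-pos⇒< : ∀ {y k x} → 1 ≤ k → y + k ≡ x → y < x
+-pos⇒< {y} 1≤k refl = m<m+n y 1≤k

Move-from-diagonal : ∀ {x y₁ y₂} → Move (x , x) (y₁ , y₂) → y₁ ≢ y₂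
Move-from-diagonal (remove₁ k 1≤k y+k≡x) = <⇒≢ (+-pos⇒< 1≤k y+k≡x)
Move-from-diagonal (remove₂ k 1≤k y+k≡x) = ≢-sym (<⇒≢ (+-pos⇒< 1≤k y+k≡x))
Move-from-diagonal {x} (transfer₁₂ k 1≤k _ y+k≡x) =
  <⇒≢ (<-trans (+-pos⇒< 1≤k y+k≡x) (m<m+n x 1≤k))
Move-from-diagonal {x} (transfer₂₁ k 1≤k _ y+k≡x) =
  ≢-sym (<⇒≢ (<-trans (+-pos⇒< 1≤k y+k≡x) (m<m+n x 1≤k)))

Move-to-diagonal : ∀ {x₁ x₂} → x₁ ≢ x₂ → ∃ λ y → Move (x₁ , x₂) (y , y)
Move-to-diagonal {x₁} {x₂} x₁≢x₂ with <-cmp x₁ x₂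
... | tri< x₁<x₂ _ _ = x₁ , remove₂ (x₂ ∸ x₁) (m<n⇒0<n∸m x₁<x₂) (m+[n∸m]≡n (<⇒≤ x₁<x₂))
... | tri≈ _ x₁≡x₂ _ = contradiction x₁≡x₂ x₁≢x₂
... | tri> _ _ x₂<x₁ = x₂ , remove₁ (x₁ ∸ x₂) (m<n⇒0<n∸m x₂<x₁) (m+[n∸m]≡n (<⇒≤ x₂<x₁))

lemma5p2 : (∀ (x₁ x₂ : ℕ) → x₁ ⊕ x₂ ≡ 0 → ∀ (y₁ y₂ : ℕ) → Move (x₁ , x₂) (y₁ , y₂) → ¬ (y₁ ⊕ y₂ ≡ 0))
    × (∀ (x₁ x₂ : ℕ) → ¬ (x₁ ⊕ x₂ ≡ 0) → Σ (ℕ × ℕ) (λ y → Move (x₁ , x₂) y × (Data.Product.proj₁ y ⊕ Data.Product.proj₂ y ≡ 0)))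
lemma5p2 = zero-to-nonzero , nonzero-to-zero
  where
  zero-to-nonzero : ∀ x₁ x₂ → x₁ ⊕ x₂ ≡ 0 → ∀ y₁ y₂ → Move (x₁ , x₂) (y₁ , y₂) → ¬ (y₁ ⊕ y₂ ≡ 0)
  zero-to-nonzero x₁ x₂ x⊕≡0 y₁ y₂ move y⊕≡0 with ⊕≡0⇒≡ {x₁} {x₂} x⊕≡0
  ... | refl = Move-from-diagonal move (⊕≡0⇒≡ y⊕≡0)

  nonzero-to-zero : ∀ x₁ x₂ → ¬ (x₁ ⊕ x₂ ≡ 0) → Σ (ℕ × ℕ) (λ y → Move (x₁ , x₂) y × (proj₁ y ⊕ proj₂ y ≡ 0))
  nonzero-to-zero x₁ x₂ x⊕≢0 with Move-to-diagonal (λ { refl → x⊕≢0 (⊕-self x₁) })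
  ... | y , move = (y , y) , move , ⊕-self y
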